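{- Let $T$ be a tree such that $V^-(T)$ is nonempty. Then each connected component of the subgraph of $T$ induced by $V^-(T)$ is isomorphic to $K_1$ or $K_2$.
   Context: A Roman dominating function (RDF) on a graph $G$ is a map $f:V(G)\to\{0,1,2\}$ such that every vertex $v$ with $f(v)=0$ has a neighbor $u$ with $f(u)=2$; its weight is $\sum_v f(v)$. $\gamma_R(G)$ is the minimum weight of an RDF on $G$. $V^-(G)=\{x\in V(G)\mid \gamma_R(G-x)+1=\gamma_R(G)\}$. -}

module Defs where

open import Level using (0ℓ)
open import Data.Nat using (ℕ; zero; suc; _+_; _≤_)
open import Data.Nat.ListAction using (sum)
open import Data.Fin using (Fin; punchIn)
open import Data.List using (List; []; _∷_; map; allFin; length; head; last)
open import Data.List.Relation.Unary.Linked using (Linked)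
open import Data.List.Relation.Unary.Unique.Propositional using (Unique)
open import Data.Maybe using (just)
open import Data.Product using (Σ; _×_; ∃; ∃-syntax; _,_)
open import Data.Sum using (_⊎_)
open import Relation.Binary.PropositionalEquality using (_≡_; _≢_)
open import Relation.Nullary using (¬_)
open import Data.Unit using (⊤)

record Graph (n : ℕ) : Set₁ where
  field
    Adj    : Fin n → Fin n → Set
    sym    : ∀ {u v} → Adj u v → Adj v u
    irrefl : ∀ {u} → ¬ Adj u u
open Graph public

data Reach {n : ℕ} (G : Graph n) (S : Fin n → Set) (u : Fin n) : Fin n → Set where
  here : S u → Reach G S u u
  step : ∀ {w v} → Reach G S u w → Adj G w v → S v → Reach G S u v

AllV : {n : ℕ} → Fin n → Set
AllV _ = ⊤

Connected : {n : ℕ} → Graph n → Set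
Connected {n} G = ∀ (u v : Fin n) → Reach G AllV u v

record Cycle {n : ℕ} (G : Graph n) : Set where
  field
    vs       : List (Fin n)
    long     : 3 ≤ length vs
    distinct : Unique vs
    path     : Linked (Adj G) vs
    closing  : ∃[ a ] ∃[ b ] (head vs ≡ just a × last vs ≡ just b × Adj G b a)

Acyclic : {n : ℕ} → Graph n → Set
Acyclic G = ¬ Cycle G

IsTree : {n : ℕ} → Graph n → Set
IsTree {n} G = (1 ≤ n) × Connected G × Acyclic G

weight : {n : ℕ} → (Fin n → ℕ) → ℕ
weight {n} f = sum (map f (allFin n))

IsRDF : {n : ℕ} → Graph n → (Fin n → ℕ) → Set
IsRDF {n} G f =
  (∀ v → f v ≤ 2) ×
  (∀ v → f v ≡ 0 → ∃[ u ] (Adj G v u × f u ≡ 2))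

IsRomanDomNumber : {n : ℕ} → Graph n → ℕ → Set
IsRomanDomNumber G k =
  (∃[ f ] (IsRDF G f × weight f ≡ k)) × (∀ f → IsRDF G f → k ≤ weight f)

delete : {m : ℕ} → Graph (suc m) → Fin (suc m) → Graph m
delete G x = record
  { Adj    = λ i j → Adj G (punchIn x i) (punchIn x j)
  ; sym    = sym G
  ; irrefl = irrefl G
  }

InVminus : {m : ℕ} → Graph (suc m) → Fin (suc m) → Set
InVminus G x = ∃[ a ] ∃[ b ]
  (IsRomanDomNumber G a × IsRomanDomNumber (delete G x) b × b + 1 ≡ a)

-- The connected component of x in the subgraph induced by S
-- (vertices v with Reach G S x v) is isomorphic to K₁: it is {x}.
ComponentK1 : {n : ℕ} → Graph n → (Fin n → Set) → Fin n → Set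
ComponentK1 G S x = ∀ v → Reach G S x v → v ≡ x

-- ... is isomorphic to K₂: it is {x , y} with y ≠ x and x y adjacent.
ComponentK2 : {n : ℕ} → Graph n → (Fin n → Set) → Fin n → Set
ComponentK2 G S x = ∃[ y ] (y ≢ x × S y × Adj G x y ×
                              (∀ v → Reach G S x v → v ≡ x ⊎ v ≡ y))

-- If x ∈ V⁻, an optimal RDF of T - x extended by 1 at x is an optimal RDF of T that is 1 at x.
-- For an edge x u of a tree, an optimal RDF that is 1 at x and one that is 1 at u can be glued
-- (the second on the branch at u, the first elsewhere): no vertex is dominated across the edge,
-- and since the two possible gluings together weigh 2γ_R, each is again optimal. So if a b c
-- were a path in V⁻, gluing would yield an optimal RDF equal to 1 on a, b and c; changing these
-- values to 0, 2, 0 would lower its weight. Hence V⁻ induces no path on three vertices.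
-- Constructively, telling K₁ from K₂ needs V⁻ to be decidable: γ_R is found by exhaustive search,
-- and adjacency in a tree is decided by inspecting the unique path.
module Submission where

open import Defs hiding (sym)
open import Data.Bool using (if_then_else_)
open import Data.Empty using (⊥; ⊥-elim)
open import Data.Fin using (Fin; zero; suc; punchIn; punchOut)
open import Data.Fin.Properties using (all?; any?; punchInᵢ≢i; punchIn-punchOut) renaming (_≟_ to _≟ᶠ_)
open import Data.List using (List; []; _∷_; last; tabulate)
open import Data.List.Properties using (map-tabulate)
open import Data.List.Relation.Unary.All using (All; []; _∷_) renaming (map to All-map)
open import Data.List.Relation.Unary.Any as Any using (Any; here; there)
open import Data.List.Relation.Unary.All.Properties.Core using (¬Any⇒All¬)
open import Data.List.Relation.Unary.AllPairs.Core using ([]; _∷_)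
open import Data.List.Relation.Unary.Linked using (Linked; []; [-]; _∷_)
open import Data.List.Relation.Unary.Unique.Propositional using (Unique)
open import Data.Maybe using (just)
open import Data.Maybe.Properties using (just-injective)
open import Data.Nat using (ℕ; zero; suc; _+_; _≤_; _<_; _≤?_; z≤n; s≤s)
open import Data.Nat.Induction using (<-wellFounded)
import Data.Nat.ListAction as List
open import Data.Nat.Properties
  using (_≟_; anyUpTo?; ≤-reflexive; ≤-trans; ≤-antisym; ≮⇒≥; <⇒≱; suc-injective; +-comm; +-suc; +-cancelʳ-≡;
         +-cancelʳ-≤; +-monoʳ-≤; module ≤-Reasoning; +-0-commutativeMonoid; +-commutativeSemigroup)
open import Algebra.Properties.CommutativeSemigroup +-commutativeSemigroup using (xy∙z≈zy∙x)
open import Algebra.Properties.CommutativeMonoid.Sum +-0-commutativeMonoid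
  using (sum; sum-remove; ∑-distrib-+; sum-cong-≗)
open import Data.Product using (∃; ∃-syntax; _×_; _,_; proj₁)
open import Data.Sum using (_⊎_; inj₁; inj₂)
open import Data.Vec.Functional as Vector using (updateAt; insertAt; removeAt; head; tail)
open import Data.Vec.Functional.Properties
  using (updateAt-updates; updateAt-minimal; insertAt-lookup; insertAt-punchIn; removeAt-insertAt)
open import Function using (id; const; _∘_)
open import Induction.WellFounded using (Acc; acc)
open import Relation.Binary.Definitions using (Decidable)
open import Relation.Binary.PropositionalEquality
  using (_≡_; _≢_; _≗_; refl; sym; trans; cong; cong₂; subst; module ≡-Reasoning)
open import Relation.Nullary using (¬_; Dec; yes; no; does; contradiction; _×-dec_; _→-dec_)
open import Relation.Nullary.Decidable using (map′)
import Relation.Unary as U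

private
  variable
    n : ℕ

listSum-tabulate : (f : Fin n → ℕ) → List.sum (tabulate f) ≡ sum f
listSum-tabulate {zero}  f = refl
listSum-tabulate {suc n} f = cong (f zero +_) (listSum-tabulate (f ∘ suc))

weight≡sum : (f : Fin n → ℕ) → weight f ≡ sum f
weight≡sum f = trans (cong List.sum (map-tabulate id f)) (listSum-tabulate f)

weight-cong : {f g : Fin n → ℕ} → f ≗ g → weight f ≡ weight g
weight-cong {f = f} {g} f≗g = begin
  weight f ≡⟨ weight≡sum f ⟩
  sum f    ≡⟨ sum-cong-≗ f≗g ⟩
  sum g    ≡⟨ weight≡sum g ⟨
  weight g ∎
  where open ≡-Reasoning

weight-+ : (f g : Fin n → ℕ) → weight (λ v → f v + g v) ≡ weight f + weight g
weight-+ f g = begin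
  weight (λ v → f v + g v) ≡⟨ weight≡sum (λ v → f v + g v) ⟩
  sum (λ v → f v + g v)    ≡⟨ ∑-distrib-+ f g ⟩
  sum f + sum g            ≡⟨ cong₂ _+_ (weight≡sum f) (weight≡sum g) ⟨
  weight f + weight g      ∎
  where open ≡-Reasoning

weight-updateAt : (f : Fin (suc n) → ℕ) (i : Fin (suc n)) (k : ℕ) →
                  weight (updateAt f i (const k)) + f i ≡ weight f + k
weight-updateAt f i k = begin
  weight f′ + f i                  ≡⟨ cong (_+ f i) (weight≡sum f′) ⟩
  sum f′ + f i                     ≡⟨ cong (_+ f i) (sum-remove {i = i} f′) ⟩
  f′ i + sum (removeAt f′ i) + f i ≡⟨ cong₂ (λ a b → a + b + f i) (updateAt-updates i f) (sum-cong-≗ unchanged) ⟩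
  k + sum (removeAt f i) + f i     ≡⟨ xy∙z≈zy∙x k _ (f i) ⟩
  f i + sum (removeAt f i) + k     ≡⟨ cong (_+ k) (sum-remove {i = i} f) ⟨
  sum f + k                        ≡⟨ cong (_+ k) (weight≡sum f) ⟨
  weight f + k                     ∎
  where
  open ≡-Reasoning
  f′ = updateAt f i (const k)
  unchanged : removeAt f′ i ≗ removeAt f i
  unchanged j = updateAt-minimal (punchIn i j) i f (punchInᵢ≢i i j)

weight-updateAt-suc : (f : Fin (suc n) → ℕ) (i : Fin (suc n)) {k : ℕ} → f i ≡ k →
                      weight (updateAt f i (const (suc k))) ≡ suc (weight f)
weight-updateAt-suc f i {k} fi≡k = +-cancelʳ-≡ k _ _ (begin
  weight (updateAt f i (const (suc k))) + k   ≡⟨ cong (weight (updateAt f i (const (suc k))) +_) fi≡k ⟨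
  weight (updateAt f i (const (suc k))) + f i ≡⟨ weight-updateAt f i (suc k) ⟩
  weight f + suc k                            ≡⟨ +-suc (weight f) k ⟩
  suc (weight f) + k                          ∎)
  where open ≡-Reasoning

weight-updateAt-pred : (f : Fin (suc n) → ℕ) (i : Fin (suc n)) {k : ℕ} → f i ≡ suc k →
                       suc (weight (updateAt f i (const k))) ≡ weight f
weight-updateAt-pred f i {k} fi≡1+k = +-cancelʳ-≡ k _ _ (begin
  suc (weight (updateAt f i (const k))) + k ≡⟨ +-suc (weight (updateAt f i (const k))) k ⟨
  weight (updateAt f i (const k)) + suc k   ≡⟨ cong (weight (updateAt f i (const k)) +_) fi≡1+k ⟨
  weight (updateAt f i (const k)) + f i     ≡⟨ weight-updateAt f i k ⟩
  weight f + k                              ∎)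
  where open ≡-Reasoning

weight-insertAt : (g : Fin n → ℕ) (x : Fin (suc n)) (k : ℕ) → weight (insertAt g x k) ≡ k + weight g
weight-insertAt g x k = begin
  weight h                  ≡⟨ weight≡sum h ⟩
  sum h                     ≡⟨ sum-remove {i = x} h ⟩
  h x + sum (removeAt h x)  ≡⟨ cong₂ _+_ (insertAt-lookup g x k) (sum-cong-≗ (removeAt-insertAt g x k)) ⟩
  k + sum g                 ≡⟨ cong (k +_) (weight≡sum g) ⟨
  k + weight g              ∎
  where
  open ≡-Reasoning
  h = insertAt g x k

MinimumRDF : Graph n → (Fin n → ℕ) → Set
MinimumRDF G f = IsRDF G f × (∀ h → IsRDF G h → weight f ≤ weight h)

module _ (G : Graph n) where

  IsRDF-resp-≗ : {f g : Fin n → ℕ} → f ≗ g → IsRDF G f → IsRDF G g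
  IsRDF-resp-≗ f≗g (bounded , dominated) =
    (λ v → subst (_≤ 2) (f≗g v) (bounded v)) ,
    λ v gv≡0 → let u , vu , fu≡2 = dominated v (trans (f≗g v) gv≡0) in u , vu , trans (sym (f≗g u)) fu≡2

  IsRDF? : Decidable (Adj G) → U.Decidable (IsRDF G)
  IsRDF? adj? f = all? (λ v → f v ≤? 2)
           ×-dec all? (λ v → f v ≟ 0 →-dec any? (λ u → adj? v u ×-dec f u ≟ 2))

  raise-IsRDF : ∀ {f} b → IsRDF G f → IsRDF G (updateAt f b (const 2))
  raise-IsRDF {f} b (bounded , dominated) = bounded′ , dominated′
    where
    f′ = updateAt f b (const 2)
    stays-2 : ∀ {u} → f u ≡ 2 → f′ u ≡ 2
    stays-2 {u} fu≡2 with u ≟ᶠ b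
    ... | yes refl = updateAt-updates b f
    ... | no u≢b  = trans (updateAt-minimal u b f u≢b) fu≡2
    bounded′ : ∀ v → f′ v ≤ 2
    bounded′ v with v ≟ᶠ b
    ... | yes refl = ≤-reflexive (updateAt-updates b f)
    ... | no v≢b  = subst (_≤ 2) (sym (updateAt-minimal v b f v≢b)) (bounded v)
    dominated′ : ∀ v → f′ v ≡ 0 → ∃[ u ] (Adj G v u × f′ u ≡ 2)
    dominated′ v f′v≡0 with v ≟ᶠ b
    ... | yes refl = contradiction (trans (sym (updateAt-updates b f)) f′v≡0) λ ()
    ... | no v≢b  =
      let u , vu , fu≡2 = dominated v (trans (sym (updateAt-minimal v b f v≢b)) f′v≡0) in u , vu , stays-2 fu≡2

  lower-IsRDF : ∀ {f a u} → IsRDF G f → f a ≢ 2 → Adj G a u → f u ≡ 2 → IsRDF G (updateAt f a (const 0))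
  lower-IsRDF {f} {a} {u} (bounded , dominated) fa≢2 au fu≡2 = bounded′ , dominated′
    where
    f′ = updateAt f a (const 0)
    stays-2 : ∀ {w} → f w ≡ 2 → f′ w ≡ 2
    stays-2 {w} fw≡2 with w ≟ᶠ a
    ... | yes refl = contradiction fw≡2 fa≢2
    ... | no w≢a  = trans (updateAt-minimal w a f w≢a) fw≡2
    bounded′ : ∀ v → f′ v ≤ 2
    bounded′ v with v ≟ᶠ a
    ... | yes refl = subst (_≤ 2) (sym (updateAt-updates a f)) z≤n
    ... | no v≢a  = subst (_≤ 2) (sym (updateAt-minimal v a f v≢a)) (bounded v)
    dominated′ : ∀ v → f′ v ≡ 0 → ∃[ w ] (Adj G v w × f′ w ≡ 2)
    dominated′ v f′v≡0 with v ≟ᶠ a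
    ... | yes refl = u , au , stays-2 fu≡2
    ... | no v≢a  =
      let w , vw , fw≡2 = dominated v (trans (sym (updateAt-minimal v a f v≢a)) f′v≡0) in w , vw , stays-2 fw≡2

-- Trading the two 1s at a and c for a 2 at b saves one unit of weight.
minimumRDF-no-path-of-ones : (G : Graph (suc n)) {F : Fin (suc n) → ℕ} {a b c : Fin (suc n)} →
                             MinimumRDF G F → Adj G a b → Adj G b c → a ≢ c →
                             F a ≡ 1 → F b ≡ 1 → F c ≡ 1 → ⊥
minimumRDF-no-path-of-ones G {F} {a} {b} {c} (F-rdf , F-min) ab bc a≢c Fa≡1 Fb≡1 Fc≡1 =
  <⇒≱ (≤-reflexive F₃-lighter) (F-min F₃ F₃-rdf)
  where
  F₁ = updateAt F b (const 2)
  F₂ = updateAt F₁ a (const 0)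
  F₃ = updateAt F₂ c (const 0)
  a≢b : a ≢ b
  a≢b refl = irrefl G ab
  c≢b : c ≢ b
  c≢b refl = irrefl G bc
  F₁a≡1 : F₁ a ≡ 1
  F₁a≡1 = trans (updateAt-minimal a b F a≢b) Fa≡1
  F₂b≡2 : F₂ b ≡ 2
  F₂b≡2 = trans (updateAt-minimal b a F₁ (a≢b ∘ sym)) (updateAt-updates b F)
  F₂c≡1 : F₂ c ≡ 1
  F₂c≡1 = trans (updateAt-minimal c a F₁ (a≢c ∘ sym)) (trans (updateAt-minimal c b F c≢b) Fc≡1)
  F₃-rdf : IsRDF G F₃
  F₃-rdf = lower-IsRDF G (lower-IsRDF G (raise-IsRDF G b F-rdf) (λ e → contradiction (trans (sym F₁a≡1) e) λ ())
                                      ab (updateAt-updates b F))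
                         (λ e → contradiction (trans (sym F₂c≡1) e) λ ()) (Defs.sym G bc) F₂b≡2
  F₃-lighter : suc (weight F₃) ≡ weight F
  F₃-lighter = suc-injective (begin
    suc (suc (weight F₃)) ≡⟨ cong suc (weight-updateAt-pred F₂ c F₂c≡1) ⟩
    suc (weight F₂)       ≡⟨ weight-updateAt-pred F₁ a F₁a≡1 ⟩
    weight F₁             ≡⟨ weight-updateAt-suc F b Fb≡1 ⟩
    suc (weight F)        ∎)
    where open ≡-Reasoning

Bounded : ℕ → (Fin n → ℕ) → Set
Bounded b f = ∀ i → f i ≤ b

∃-bounded? : ∀ {ℓ} n b {Q : U.Pred (Fin n → ℕ) ℓ} → (∀ {f g} → f ≗ g → Q f → Q g) → U.Decidable Q →
             Dec (∃[ f ] (Bounded b f × Q f))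
∃-bounded? zero    b resp Q? = map′ (λ q → Vector.[] , (λ ()) , q) (λ (_ , _ , q) → resp (λ ()) q) (Q? Vector.[])
∃-bounded? (suc n) b {Q} resp Q? =
  map′ cons uncons (anyUpTo? (λ c → ∃-bounded? n b (resp ∘ ∷-cong c) (Q? ∘ (c Vector.∷_))) (suc b))
  where
  ∷-cong : ∀ c {f g} → f ≗ g → c Vector.∷ f ≗ c Vector.∷ g
  ∷-cong c f≗g zero    = refl
  ∷-cong c f≗g (suc i) = f≗g i
  cons : (∃[ c ] (c < suc b × ∃[ g ] (Bounded b g × Q (c Vector.∷ g)))) → ∃[ f ] (Bounded b f × Q f)
  cons (c , s≤s c≤b , g , g≤b , q) = c Vector.∷ g , (λ { zero → c≤b ; (suc i) → g≤b i }) , q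
  uncons : ∃[ f ] (Bounded b f × Q f) → ∃[ c ] (c < suc b × ∃[ g ] (Bounded b g × Q (c Vector.∷ g)))
  uncons (f , f≤b , q) = head f , s≤s (f≤b zero) , tail f , f≤b ∘ suc , resp (λ { zero → refl ; (suc i) → refl }) q

least-witness : ∀ {ℓ} {P : U.Pred ℕ ℓ} → U.Decidable P → ∀ {k} → P k → ∃[ j ] (P j × ∀ {i} → P i → j ≤ i)
least-witness {P = P} P? {k} pk = descend pk (<-wellFounded k)
  where
  descend : ∀ {k} → P k → Acc _<_ k → ∃[ j ] (P j × ∀ {i} → P i → j ≤ i)
  descend {k} pk (acc smaller) with anyUpTo? P? k
  ... | yes (i , i<k , pi) = descend pi (smaller i<k)
  ... | no none            = k , pk , λ {i} pi → ≮⇒≥ (λ i<k → none (i , i<k , pi))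

romanDomNumber : (G : Graph n) → Decidable (Adj G) → ∃ (IsRomanDomNumber G)
romanDomNumber G adj? =
  let γ , has-γ , least = least-witness {P = HasRDFOfWeight} RDF-of-weight? (ones , ones-rdf , refl)
  in  γ , has-γ , λ f f-rdf → least (f , f-rdf , refl)
  where
  ones : Fin n → ℕ
  ones = const 1
  ones-rdf : IsRDF G ones
  ones-rdf = (λ _ → s≤s z≤n) , λ _ ()
  HasRDFOfWeight : ℕ → Set
  HasRDFOfWeight k = ∃[ f ] (IsRDF G f × weight f ≡ k)
  RDF-of-weight? : U.Decidable HasRDFOfWeight
  RDF-of-weight? k =
    map′ (λ (f , _ , rdf-of-weight) → f , rdf-of-weight) (λ (f , f-rdf , wf≡k) → f , proj₁ f-rdf , f-rdf , wf≡k)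
         (∃-bounded? _ 2 (λ f≗g (f-rdf , wf≡k) → IsRDF-resp-≗ G f≗g f-rdf , trans (sym (weight-cong f≗g)) wf≡k)
                         (λ f → IsRDF? G adj? f ×-dec weight f ≟ k))

romanDomNumber-unique : {G : Graph n} {a b : ℕ} → IsRomanDomNumber G a → IsRomanDomNumber G b → a ≡ b
romanDomNumber-unique ((f , f-rdf , wf≡a) , a-least) ((g , g-rdf , wg≡b) , b-least) =
  ≤-antisym (subst (_ ≤_) wg≡b (a-least g g-rdf)) (subst (_ ≤_) wf≡a (b-least f f-rdf))

-- Splicing two Roman dominating functions across a bridge

splice : {D : Fin n → Set} → U.Decidable D → (Fin n → ℕ) → (Fin n → ℕ) → Fin n → ℕ
splice D? g f v = if does (D? v) then g v else f v

module _ {D : Fin n → Set} (D? : U.Decidable D) {g f : Fin n → ℕ} where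

  splice-inside : ∀ {v} → D v → splice D? g f v ≡ g v
  splice-inside {v} v∈D with D? v
  ... | yes _   = refl
  ... | no v∉D = contradiction v∈D v∉D

  splice-outside : ∀ {v} → ¬ D v → splice D? g f v ≡ f v
  splice-outside {v} v∉D with D? v
  ... | yes v∈D = contradiction v∈D v∉D
  ... | no _    = refl

  weight-splice : weight (splice D? g f) + weight (splice D? f g) ≡ weight g + weight f
  weight-splice = begin
    weight (splice D? g f) + weight (splice D? f g)  ≡⟨ weight-+ (splice D? g f) (splice D? f g) ⟨
    weight (λ v → splice D? g f v + splice D? f g v) ≡⟨ weight-cong pointwise ⟩
    weight (λ v → g v + f v)                         ≡⟨ weight-+ g f ⟩
    weight g + weight f                              ∎
    where
    open ≡-Reasoning
    pointwise : ∀ v → splice D? g f v + splice D? f g v ≡ g v + f v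
    pointwise v with D? v
    ... | yes _ = refl
    ... | no _  = +-comm (f v) (g v)

module _ (G : Graph n) {D : Fin n → Set} (D? : U.Decidable D) {p q : Fin n}
         (bridge : ∀ {a b} → D a → ¬ D b → Adj G a b → a ≡ p × b ≡ q) where

  splice-IsRDF : ∀ {g f} → IsRDF G g → IsRDF G f → ¬ (g p ≡ 0 × g q ≡ 2) → ¬ (f q ≡ 0 × f p ≡ 2) →
                 IsRDF G (splice D? g f)
  splice-IsRDF {g} {f} (g-bounded , g-dominated) (f-bounded , f-dominated) g-no-cross f-no-cross =
    bounded , dominated
    where
    bounded : ∀ v → splice D? g f v ≤ 2
    bounded v with D? v
    ... | yes _ = g-bounded v
    ... | no _  = f-bounded v
    dominated : ∀ v → splice D? g f v ≡ 0 → ∃[ u ] (Adj G v u × splice D? g f u ≡ 2)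
    dominated v hv≡0 with D? v
    dominated v gv≡0 | yes v∈D with g-dominated v gv≡0
    ... | u , vu , gu≡2 with D? u
    ...   | yes u∈D = u , vu , trans (splice-inside D? {g} {f} u∈D) gu≡2
    ...   | no u∉D  with bridge v∈D u∉D vu
    ...     | refl , refl = contradiction (gv≡0 , gu≡2) g-no-cross
    dominated v fv≡0 | no v∉D with f-dominated v fv≡0
    ... | u , vu , fu≡2 with D? u
    ...   | no u∉D  = u , vu , trans (splice-outside D? {g} {f} u∉D) fu≡2
    ...   | yes u∈D with bridge u∈D v∉D (Defs.sym G vu)
    ...     | refl , refl = contradiction (fv≡0 , fu≡2) f-no-cross

  -- The two splices together weigh as much as g and f, and the other one weighs at least as much as f.
  splice-minimumRDF : ∀ {g f} → MinimumRDF G g → MinimumRDF G f → g p ≡ 1 → f q ≡ 1 →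
                      MinimumRDF G (splice D? g f)
  splice-minimumRDF {g} {f} (g-rdf , g-min) (f-rdf , f-min) gp≡1 fq≡1 =
    h-rdf , λ k k-rdf → ≤-trans h≤g (g-min k k-rdf)
    where
    h = splice D? g f
    h′ = splice D? f g
    h-rdf : IsRDF G h
    h-rdf = splice-IsRDF g-rdf f-rdf (λ (gp≡0 , _) → contradiction (trans (sym gp≡1) gp≡0) λ ())
                                     (λ (fq≡0 , _) → contradiction (trans (sym fq≡1) fq≡0) λ ())
    h′-rdf : IsRDF G h′
    h′-rdf = splice-IsRDF f-rdf g-rdf (λ (_ , fq≡2) → contradiction (trans (sym fq≡1) fq≡2) λ ())
                                      (λ (_ , gp≡2) → contradiction (trans (sym gp≡1) gp≡2) λ ())
    h≤g : weight h ≤ weight g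
    h≤g = +-cancelʳ-≤ (weight f) (weight h) (weight g) (begin
      weight h + weight f  ≤⟨ +-monoʳ-≤ (weight h) (f-min h′ h′-rdf) ⟩
      weight h + weight h′ ≡⟨ weight-splice D? ⟩
      weight g + weight f  ∎)
      where open ≤-Reasoning

x-or-punchIn : (x v : Fin (suc n)) → v ≡ x ⊎ ∃[ j ] (punchIn x j ≡ v)
x-or-punchIn x v with v ≟ᶠ x
... | yes v≡x = inj₁ v≡x
... | no v≢x  = inj₂ (punchOut (v≢x ∘ sym) , punchIn-punchOut (v≢x ∘ sym))

insertAt-IsRDF : (G : Graph (suc n)) (x : Fin (suc n)) {g : Fin n → ℕ} →
                 IsRDF (delete G x) g → IsRDF G (insertAt g x 1)
insertAt-IsRDF G x {g} (bounded , dominated) = bounded′ , dominated′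
  where
  bounded′ : ∀ v → insertAt g x 1 v ≤ 2
  bounded′ v with x-or-punchIn x v
  ... | inj₁ refl       = subst (_≤ 2) (sym (insertAt-lookup g x 1)) (s≤s z≤n)
  ... | inj₂ (j , refl) = subst (_≤ 2) (sym (insertAt-punchIn g x 1 j)) (bounded j)
  dominated′ : ∀ v → insertAt g x 1 v ≡ 0 → ∃[ u ] (Adj G v u × insertAt g x 1 u ≡ 2)
  dominated′ v hv≡0 with x-or-punchIn x v
  ... | inj₁ refl       = contradiction (trans (sym (insertAt-lookup g x 1)) hv≡0) λ ()
  ... | inj₂ (j , refl) =
    let i , ji , gi≡2 = dominated j (trans (sym (insertAt-punchIn g x 1 j)) hv≡0)
    in  punchIn x i , ji , trans (insertAt-punchIn g x 1 i) gi≡2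

InVminus⇒minimumRDF : (G : Graph (suc n)) {x : Fin (suc n)} → InVminus G x →
                      ∃[ f ] (MinimumRDF G f × f x ≡ 1)
InVminus⇒minimumRDF G {x} (a , b , (_ , a-least) , ((g , g-rdf , wg≡b) , _) , b+1≡a) =
  insertAt g x 1 ,
  (insertAt-IsRDF G x g-rdf , λ h h-rdf → subst (_≤ weight h) (sym weight≡a) (a-least h h-rdf)) ,
  insertAt-lookup g x 1
  where
  weight≡a : weight (insertAt g x 1) ≡ a
  weight≡a = trans (weight-insertAt g x 1) (trans (cong suc wg≡b) (trans (+-comm 1 b) b+1≡a))

InVminus? : (G : Graph (suc n)) → Decidable (Adj G) → U.Decidable (InVminus G)
InVminus? G adj? x =
  let a , γ[G]≡a   = romanDomNumber G adj?
      b , γ[G-x]≡b = romanDomNumber (delete G x) (λ i j → adj? (punchIn x i) (punchIn x j))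
  in  map′ (λ b+1≡a → a , b , γ[G]≡a , γ[G-x]≡b , b+1≡a)
           (λ (a′ , b′ , γ[G]≡a′ , γ[G-x]≡b′ , b′+1≡a′) →
              trans (cong (_+ 1) (romanDomNumber-unique {G = delete G x} γ[G-x]≡b γ[G-x]≡b′))
                    (trans b′+1≡a′ (romanDomNumber-unique {G = G} γ[G]≡a′ γ[G]≡a)))
           (b + 1 ≟ a)

module _ {G : Graph n} {S : Fin n → Set} where

  reach-end : ∀ {u v} → Reach G S u v → S v
  reach-end (here s)     = s
  reach-end (step _ _ s) = s

  reach-trans : ∀ {u v w} → Reach G S u v → Reach G S v w → Reach G S u w
  reach-trans r (here _)        = r
  reach-trans r (step r′ vw sw) = step (reach-trans r r′) vw sw

  reach-sym : ∀ {u v} → Reach G S u v → Reach G S v u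
  reach-sym (here s)       = here s
  reach-sym (step r wv sv) = reach-trans (step (here sv) (Defs.sym G wv) (reach-end r)) (reach-sym r)

  -- The vertices run from v back to u.
  record SimplePath (u v : Fin n) : Set where
    field
      rest     : List (Fin n)
      ends     : last (v ∷ rest) ≡ just u
      distinct : Unique (v ∷ rest)
      linked   : Linked (Adj G) (v ∷ rest)
      inside   : All S (v ∷ rest)

  simplePath-suffix : ∀ {u v} xs → Any (v ≡_) xs → last xs ≡ just u → Unique xs → Linked (Adj G) xs → All S xs →
                      SimplePath u v
  simplePath-suffix (_ ∷ ys) (here refl) e d l i =
    record { rest = ys ; ends = e ; distinct = d ; linked = l ; inside = i }
  simplePath-suffix (_ ∷ z ∷ zs) (there v∈zs) e (_ ∷ d) (_ ∷ l) (_ ∷ i) = simplePath-suffix (z ∷ zs) v∈zs e d l i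

  reach⇒simplePath : ∀ {u v} → Reach G S u v → SimplePath u v
  reach⇒simplePath (here s) =
    record { rest = [] ; ends = refl ; distinct = [] ∷ [] ; linked = [-] ; inside = s ∷ [] }
  reach⇒simplePath (step {w} {v} r wv sv) with reach⇒simplePath r
  ... | record { rest = rest ; ends = ends ; distinct = distinct ; linked = linked ; inside = inside }
      with Any.any? (v ≟ᶠ_) (w ∷ rest)
  ...   | yes v∈path = simplePath-suffix (w ∷ rest) v∈path ends distinct linked inside
  ...   | no v∉path  = record
    { rest = w ∷ rest ; ends = ends ; distinct = ¬Any⇒All¬ (w ∷ rest) v∉path ∷ distinct
    ; linked = Defs.sym G wv ∷ linked ; inside = sv ∷ inside }

walk-avoids-or-meets : {G : Graph n} {x v t : Fin n} → v ≢ x → Reach G AllV v t →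
                       (∃[ p ] (Adj G p x × Reach G (_≢ x) v p)) ⊎ Reach G (_≢ x) v t
walk-avoids-or-meets v≢x (here _) = inj₂ (here v≢x)
walk-avoids-or-meets {x = x} v≢x (step {w} {t} r wt _) with walk-avoids-or-meets v≢x r
... | inj₁ meets = inj₁ meets
... | inj₂ avoids with t ≟ᶠ x
...   | yes refl = inj₁ (w , wt , avoids)
...   | no t≢x   = inj₂ (step avoids wt t≢x)

NoPathOfThree : Graph n → (Fin n → Set) → Set
NoPathOfThree G S = ∀ {a b c} → S a → S b → S c → Adj G a b → Adj G b c → a ≢ c → ⊥

isolated⇒componentK1 : (G : Graph n) {S : Fin n → Set} {x : Fin n} →
                       (∀ y → Adj G x y → ¬ S y) → ComponentK1 G S x
isolated⇒componentK1 G isolated v (here _) = refl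
isolated⇒componentK1 G isolated v (step {w} r wv sv) with isolated⇒componentK1 G isolated w r
... | refl = contradiction sv (isolated v wv)

edge⇒componentK2 : (G : Graph n) {S : Fin n → Set} {x y : Fin n} → NoPathOfThree G S →
                   S x → S y → Adj G x y → ComponentK2 G S x
edge⇒componentK2 G {S} {x} {y} no-P₃ sx sy xy = y , (λ { refl → irrefl G xy }) , sy , xy , within
  where
  within : ∀ v → Reach G S x v → v ≡ x ⊎ v ≡ y
  within v (here _) = inj₁ refl
  within v (step {w} r wv sv) with within w r
  ... | inj₁ refl with v ≟ᶠ y
  ...   | yes v≡y = inj₂ v≡y
  ...   | no v≢y  = ⊥-elim (no-P₃ sy sx sv (Defs.sym G xy) wv (v≢y ∘ sym))
  within v (step {w} r wv sv) | inj₂ refl with v ≟ᶠ x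
  ...   | yes v≡x = inj₁ v≡x
  ...   | no v≢x  = ⊥-elim (no-P₃ sx sy sv xy wv (v≢x ∘ sym))

component-K1⊎K2 : (G : Graph n) {S : Fin n → Set} → Decidable (Adj G) → U.Decidable S → NoPathOfThree G S →
                  ∀ {x} → S x → ComponentK1 G S x ⊎ ComponentK2 G S x
component-K1⊎K2 G adj? S? no-P₃ {x} sx with any? (λ y → adj? x y ×-dec S? y)
... | yes (y , xy , sy) = inj₂ (edge⇒componentK2 G no-P₃ sx sy xy)
... | no no-neighbour   = inj₁ (isolated⇒componentK1 G λ y xy sy → no-neighbour (y , xy , sy))

Branch : Graph n → Fin n → Fin n → Fin n → Set
Branch G x u = Reach G (_≢ x) u

x∉Branch : {G : Graph n} {x u : Fin n} → ¬ Branch G x u x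
x∉Branch ux = reach-end ux refl

module _ {T : Graph n} (acyclic : Acyclic T) where

  neighbours-in-distinct-branches : ∀ {x a b} → Adj T x a → Adj T x b → a ≢ b → ¬ Branch T x a b
  neighbours-in-distinct-branches {x} {a} {b} xa xb a≢b ab with reach⇒simplePath ab
  ... | record { rest = [] ; ends = ends } = a≢b (sym (just-injective ends))
  ... | record { rest = c ∷ cs ; ends = ends ; distinct = distinct ; linked = linked ; inside = inside } =
    acyclic record
      { vs       = x ∷ b ∷ c ∷ cs
      ; long     = s≤s (s≤s (s≤s z≤n))
      ; distinct = All-map (_∘ sym) inside ∷ distinct
      ; path     = xb ∷ linked
      ; closing  = x , a , refl , ends , Defs.sym T xa
      }

  branch-bridge : ∀ {x u a b} → Adj T x u → Branch T x u a → ¬ Branch T x u b → Adj T a b → a ≡ u × b ≡ x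
  branch-bridge {x} {u} {a} {b} xu ua ¬ub ab with b ≟ᶠ x
  ... | no b≢x  = contradiction (step ua ab b≢x) ¬ub
  ... | yes refl with a ≟ᶠ u
  ...   | yes a≡u = a≡u , refl
  ...   | no a≢u  = contradiction ua (neighbours-in-distinct-branches xu (Defs.sym T ab) (a≢u ∘ sym))

module _ {T : Graph n} (connected : Connected T) (acyclic : Acyclic T) where

  -- u and v are adjacent iff the unique path between them has exactly one edge.
  tree-adj? : Decidable (Adj T)
  tree-adj? u v with reach⇒simplePath (connected u v)
  ... | record { rest = [] ; ends = ends } =
    no λ uv → irrefl T (subst (λ t → Adj T t v) (sym (just-injective ends)) uv)
  ... | record { rest = _ ∷ [] ; ends = ends ; linked = vc ∷ _ } =
    yes (Defs.sym T (subst (Adj T v) (just-injective ends) vc))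
  ... | record { rest = c ∷ d ∷ ds ; ends = ends ; distinct = distinct ; linked = linked } = no λ uv →
    acyclic record
      { vs = v ∷ c ∷ d ∷ ds ; long = s≤s (s≤s (s≤s z≤n)) ; distinct = distinct ; path = linked
      ; closing = v , u , refl , ends , uv }

  gateway : ∀ {x v} → v ≢ x → ∃[ p ] (Adj T p x × Branch T x v p)
  gateway v≢x with walk-avoids-or-meets v≢x (connected _ _)
  ... | inj₁ meets  = meets
  ... | inj₂ avoids = contradiction refl (reach-end avoids)

  -- v is in the branch at u exactly when its gateway to x is u.
  branch? : ∀ {x u} → Adj T x u → U.Decidable (Branch T x u)
  branch? {x} {u} xu v with v ≟ᶠ x
  ... | yes refl = no x∉Branch
  ... | no v≢x with gateway v≢x
  ...   | p , px , vp with p ≟ᶠ u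
  ...     | yes refl = yes (reach-sym vp)
  ...     | no p≢u   = no λ uv →
    neighbours-in-distinct-branches acyclic xu (Defs.sym T px) (p≢u ∘ sym) (reach-trans uv vp)

  graft : ∀ {x u f g} → Adj T x u → MinimumRDF T f → f x ≡ 1 → MinimumRDF T g → g u ≡ 1 →
          ∃[ h ] (MinimumRDF T h × h u ≡ 1 × (∀ {v} → ¬ Branch T x u v → h v ≡ f v))
  graft {f = f} {g} xu f-min fx≡1 g-min gu≡1 =
    splice D? g f ,
    splice-minimumRDF T D? (branch-bridge acyclic xu) g-min f-min gu≡1 fx≡1 ,
    trans (splice-inside D? {g} {f} (here λ { refl → irrefl T xu })) gu≡1 ,
    splice-outside D? {g} {f}
    where D? = branch? xu

Vminus-noPathOfThree : {T : Graph (suc n)} → Connected T → Acyclic T → NoPathOfThree T (InVminus T)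
Vminus-noPathOfThree {T = T} connected acyclic {a} {b} {c} a∈V⁻ b∈V⁻ c∈V⁻ ab bc a≢c
  with InVminus⇒minimumRDF T b∈V⁻ | InVminus⇒minimumRDF T a∈V⁻ | InVminus⇒minimumRDF T c∈V⁻
... | f , f-min , fb≡1 | g , g-min , ga≡1 | k , k-min , kc≡1
  with graft connected acyclic (Defs.sym T ab) f-min fb≡1 g-min ga≡1
... | h , h-min , ha≡1 , h-off
  with graft connected acyclic bc h-min (trans (h-off x∉Branch) fb≡1) k-min kc≡1
... | h′ , h′-min , h′c≡1 , h′-off =
  minimumRDF-no-path-of-ones T h′-min ab bc a≢c
    (trans (h′-off a∉) ha≡1) (trans (h′-off x∉Branch) (trans (h-off x∉Branch) fb≡1)) h′c≡1
  where
  a∉ : ¬ Branch T b c a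
  a∉ = neighbours-in-distinct-branches acyclic bc (Defs.sym T ab) (a≢c ∘ sym)

lemma3p5 : ∀ {m : ℕ} (T : Graph (suc m)) → IsTree T →
    ∃[ x ] InVminus T x →
    ∀ (x : Fin (suc m)) → InVminus T x →
      ComponentK1 T (InVminus T) x ⊎ ComponentK2 T (InVminus T) x
-- The nonemptiness hypothesis is implied by x ∈ V⁻.
lemma3p5 T (_ , connected , acyclic) _ x =
  component-K1⊎K2 T adj? (InVminus? T adj?) (Vminus-noPathOfThree connected acyclic)
  where adj? = tree-adj? connected acyclic
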